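{- Let $k\in\mathbb{N}$, let $\alpha_1,\ldots,\alpha_{2k}$ be natural numbers, and let $G=C(\alpha_1,\ldots,\alpha_{2k})$. Then the characteristic polynomial $\psi_\pi(x)=\det(Q_\pi(G)-xI)$ of the quotient matrix $Q_\pi(G)$ satisfies, for all $x$ with $\alpha_{2i-1}-1-x\neq 0$ and $\alpha_{2i}+x\neq 0$ for all $i$, $$\psi_\pi(x)=(-1)^k\prod_{i=1}^k(\alpha_{2i-1}-1-x)(\alpha_{2i}+x)\;T(\beta_1,\beta_2,\ldots,\beta_{2k}),$$ where $\beta_1=\dfrac{1+x}{\alpha_1-1-x}$, $\beta_i=\dfrac{\alpha_i}{\alpha_i-1-x}$ for odd $i\ge 3$, and $\beta_i=\dfrac{\alpha_i}{\alpha_i+x}$ for even $i$.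
   Context: For natural numbers $\alpha_1,\ldots,\alpha_m$, the graph $C(\alpha_1,\ldots,\alpha_m)$ is defined recursively: $C(\alpha_1)=\overline{K_{\alpha_1}}$ (edgeless graph on $\alpha_1$ vertices), and $C(\alpha_1,\ldots,\alpha_i)=\overline{C(\alpha_1,\ldots,\alpha_{i-1})\cup K_{\alpha_i}}$ for $i\ge 2$ (disjoint union with the complete graph $K_{\alpha_i}$, followed by complementation). For $G=C(\alpha_1,\ldots,\alpha_{2k})$, let $C_i$ be the set of $\alpha_i$ vertices added at the $i$-th step; the quotient matrix $Q_\pi(G)=[q_{ij}]_{1\le i,j\le 2k}$ of the equitable partition $\{C_1,\ldots,C_{2k}\}$ is: for $i$ odd, $q_{ii}=\alpha_i-1$, $q_{ij}=0$ for $j<i$, and for $j>i$, $q_{ij}=\alpha_j$ if $j$ is even and $0$ if $j$ is odd; for $i$ even, $q_{ii}=0$, $q_{ij}=\alpha_j$ for $j<i$, and for $j>i$, $q_{ij}=\alpha_j$ if $j$ is even and $0$ if $j$ is odd. For reals $\beta_1,\ldots,\beta_n$, $T(\beta_1,\ldots,\beta_n)$ denotes the determinant of the $n\times n$ tridiagonal matrix with diagonal $\beta_1,\ldots,\beta_n$, superdiagonal entries all $-1$ and subdiagonal entries all $1$. -}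

module Defs where

open import Level using (Level; _⊔_) renaming (suc to lsuc)
open import Algebra.Bundles using (CommutativeRing)
open import Data.Nat as ℕ using (ℕ; zero; suc)
open import Data.Bool using (Bool; true; false; if_then_else_)
open import Data.Fin using (Fin; toℕ; punchIn) renaming (zero to fzero; suc to fsuc)
open import Relation.Nullary using (¬_; yes; no)
open import Relation.Nullary.Decidable using (⌊_⌋)

record Field (c ℓ : Level) : Set (lsuc (c ⊔ ℓ)) where
  field
    commutativeRing : CommutativeRing c ℓ
  open CommutativeRing commutativeRing public
  field
    _⁻¹        : Carrier → Carrier
    ⁻¹-inverse : ∀ y → ¬ (y ≈ 0#) → y * (y ⁻¹) ≈ 1#
    0≉1        : ¬ (0# ≈ 1#)

isEven : ℕ → Bool
isEven zero = true
isEven (suc n) = not' (isEven n)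
  where
  not' : Bool → Bool
  not' true = false
  not' false = true

module _ {c ℓ : Level} (F : Field c ℓ) where
  open Field F

  Matrix : ℕ → Set c
  Matrix n = Fin n → Fin n → Carrier

  fromℕ : ℕ → Carrier
  fromℕ zero = 0#
  fromℕ (suc n) = 1# + fromℕ n

  negOnePow : ℕ → Carrier
  negOnePow zero = 1#
  negOnePow (suc k) = - negOnePow k

  prodFrom1 : ℕ → (ℕ → Carrier) → Carrier
  prodFrom1 zero f = 1#
  prodFrom1 (suc k) f = prodFrom1 k f * f (suc k)

  sumFin : (n : ℕ) → (Fin n → Carrier) → Carrier
  sumFin zero f = 0#
  sumFin (suc n) f = f fzero + sumFin n (λ j → f (fsuc j))

  signFin : ∀ {n} → Fin n → Carrier
  signFin j = negOnePow (toℕ j)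

  det : (n : ℕ) → Matrix n → Carrier
  det zero M = 1#
  det (suc n) M =
    sumFin (suc n) (λ j → signFin j * (M fzero j * det n (λ a b → M (fsuc a) (punchIn j b))))

  tridiag : (n : ℕ) → (ℕ → Carrier) → Matrix n
  tridiag n β i j =
    if ⌊ toℕ i ℕ.≟ toℕ j ⌋ then β (suc (toℕ i))
    else if ⌊ suc (toℕ i) ℕ.≟ toℕ j ⌋ then - 1#
    else if ⌊ toℕ i ℕ.≟ suc (toℕ j) ⌋ then 1#
    else 0#

  T : (n : ℕ) → (ℕ → Carrier) → Carrier
  T n β = det n (tridiag n β)

  -- Rows/columns i : Fin (2k) stand for the
  -- 1-indexed classes C_{toℕ i + 1}; α is 1-indexed (only α 1 … α (2k) matter).
  -- A 1-indexed index m = toℕ i + 1 is odd iff toℕ i is even.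
  quotientMatrix : (k : ℕ) → (ℕ → ℕ) → Matrix (2 ℕ.* k)
  quotientMatrix k α i j =
    if ⌊ toℕ i ℕ.≟ toℕ j ⌋
      then (if isEven (toℕ i) then fromℕ (α (suc (toℕ i))) - 1# else 0#)
    else if ⌊ toℕ j ℕ.<? toℕ i ⌋
      then (if isEven (toℕ i) then 0# else fromℕ (α (suc (toℕ j))))
    else (if isEven (toℕ j) then 0# else fromℕ (α (suc (toℕ j))))

  idMatrix : (n : ℕ) → Matrix n
  idMatrix n i j = if ⌊ toℕ i ℕ.≟ toℕ j ⌋ then 1# else 0#

  charPolyQ : (k : ℕ) → (ℕ → ℕ) → Carrier → Carrier
  charPolyQ k α x = det (2 ℕ.* k) (λ i j → quotientMatrix k α i j - x * idMatrix (2 ℕ.* k) i j)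

  betaSeq : (ℕ → ℕ) → Carrier → ℕ → Carrier
  betaSeq α x 1 = (1# + x) * ((fromℕ (α 1) - 1# - x) ⁻¹)
  betaSeq α x i =
    if isEven i then fromℕ (α i) * ((fromℕ (α i) + x) ⁻¹)
    else fromℕ (α i) * ((fromℕ (α i) - 1# - x) ⁻¹)

-- The determinant of Q_π(G) − xI is transformed by adjacent row operations, for which the
-- Laplace expansion of Defs only has to be shown linear in each row and zero on two equal adjacent rows.
-- Replacing row 0 by row 0 minus row 1 and every later row r by row (r − 1) minus row (r + 1) (first
-- subtracting the next row top-down, then adding the previous one bottom-up) leaves a tridiagonal matrix:
-- two classes of equal parity see every class outside the three between them in the same way, and the
-- would-be row 2k vanishes on the first 2k columns, so the last row fits the pattern too. Factoring
-- α_i + x or −(α_i − 1 − x) out of row i turns the diagonal into β_i and each product of opposite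
-- off-diagonal entries into −1; the factors multiply to (−1)^k ∏ (α_{2i−1} − 1 − x)(α_{2i} + x).

module Submission where

open import Defs
open import Level using (Level)
open import Algebra.Bundles using (CommutativeRing)
open import Algebra.Solver.Ring.AlmostCommutativeRing
  using (AlmostCommutativeRing; fromCommutativeRing; _-Raw-AlmostCommutative⟶_)
import Algebra.Solver.Ring as RingSolver
open import Data.Bool using (Bool; true; false; if_then_else_; T?)
open import Data.Fin as Fin using (Fin; toℕ; punchIn; inject₁; fromℕ<) renaming (zero to fzero; suc to fsuc)
import Data.Fin.Properties as Fin
open import Data.Integer as ℤ using (ℤ; +_; -[1+_]; _⊖_)
import Data.Integer.Properties as ℤ
open import Data.Maybe using (Maybe; just; nothing)
open import Data.Nat as ℕ using (ℕ; zero; suc; pred; _<_; _≤_; _<?_; _≟_; _∸_; z≤n; s≤s) renaming (_*_ to _*ℕ_)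
import Data.Nat.Properties as ℕ
open import Data.Product using (_,_; ∃)
open import Data.Sign as Sign using (Sign)
open import Data.Sum using (_⊎_; inj₁; inj₂)
open import Function using (_∘_)
open import Relation.Binary.Definitions using (Tri; tri<; tri≈; tri>)
open import Relation.Binary.PropositionalEquality as ≡ using (_≡_; _≢_; _≗_)
open import Relation.Nullary using (¬_; yes; no; contradiction)
open import Relation.Nullary.Decidable using (⌊_⌋; ⌊⌋-map′)

if⌊<?⌋-< : ∀ {a} {A : Set a} {r t} (y z : A) → r < t → (if ⌊ r <? t ⌋ then y else z) ≡ y
if⌊<?⌋-< {r = r} {t} y z r<t with r <? t
... | yes _  = ≡.refl
... | no r≮t = contradiction r<t r≮t

if⌊<?⌋-≥ : ∀ {a} {A : Set a} {r t} (y z : A) → t ≤ r → (if ⌊ r <? t ⌋ then y else z) ≡ z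
if⌊<?⌋-≥ {r = r} {t} y z t≤r with r <? t
... | yes r<t = contradiction t≤r (ℕ.<⇒≱ r<t)
... | no _    = ≡.refl

if⌊≟⌋-refl : ∀ {a} {A : Set a} r (y z : A) → (if ⌊ r ≟ r ⌋ then y else z) ≡ y
if⌊≟⌋-refl r y z with r ≟ r
... | yes _  = ≡.refl
... | no r≢r = contradiction ≡.refl r≢r

if⌊≟⌋-≢ : ∀ {a} {A : Set a} {r t} (y z : A) → r ≢ t → (if ⌊ r ≟ t ⌋ then y else z) ≡ z
if⌊≟⌋-≢ {r = r} {t} y z r≢t with r ≟ t
... | yes r≡t = contradiction r≡t r≢t
... | no _    = ≡.refl

module IntegerCoefficients {c ℓ : Level} (R : CommutativeRing c ℓ) where
  open CommutativeRing R
  open import Algebra.Properties.Ring ring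
    using (-0#≈0#; -‿involutive; -‿+-comm; -‿distribˡ-*; -‿distribʳ-*)
  open import Algebra.Properties.Semiring.Mult.TCOptimised semiring
    using (_×_; 1+×; ×-homo-+; ×1-homo-*)
  open import Relation.Binary.Reasoning.Setoid setoid

  -- The TC-optimised _×_ makes ι (+ 0) and ι (+ 1) reduce to 0# and 1#, so 0-homo and 1-homo below are refl.
  ι : ℤ → Carrier
  ι (+ n)    = n × 1#
  ι -[1+ n ] = - (suc n × 1#)

  private
    +-interchange : ∀ p q r s → (p + q) + (r + s) ≈ (p + r) + (q + s)
    +-interchange p q r s = begin
      (p + q) + (r + s) ≈⟨ +-assoc p q (r + s) ⟩
      p + (q + (r + s)) ≈⟨ +-congˡ (+-assoc q r s) ⟨
      p + ((q + r) + s) ≈⟨ +-congˡ (+-congʳ (+-comm q r)) ⟩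
      p + ((r + q) + s) ≈⟨ +-congˡ (+-assoc r q s) ⟩
      p + (r + (q + s)) ≈⟨ +-assoc p r (q + s) ⟨
      (p + r) + (q + s) ∎

  ι-⊖ : ∀ m n → ι (m ⊖ n) ≈ m × 1# - n × 1#
  ι-⊖ m zero = begin
    ι (m ⊖ 0)    ≡⟨ ≡.cong ι (ℤ.⊖-≥ {m} ℕ.z≤n) ⟩
    m × 1#       ≈⟨ +-identityʳ _ ⟨
    m × 1# + 0#  ≈⟨ +-congˡ -0#≈0# ⟨
    m × 1# - 0#  ∎
  ι-⊖ zero (suc n) = sym (+-identityˡ _)
  ι-⊖ (suc m) (suc n) = begin
    ι (suc m ⊖ suc n)                     ≡⟨ ≡.cong ι (ℤ.[1+m]⊖[1+n]≡m⊖n m n) ⟩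
    ι (m ⊖ n)                             ≈⟨ ι-⊖ m n ⟩
    m × 1# - n × 1#                       ≈⟨ +-identityˡ _ ⟨
    0# + (m × 1# - n × 1#)                ≈⟨ +-congʳ (-‿inverseʳ 1#) ⟨
    (1# - 1#) + (m × 1# - n × 1#)         ≈⟨ +-interchange 1# (- 1#) (m × 1#) (- (n × 1#)) ⟩
    (1# + m × 1#) + (- 1# - n × 1#)       ≈⟨ +-cong (sym (1+× m 1#)) (-‿+-comm 1# (n × 1#)) ⟩
    suc m × 1# - (1# + n × 1#)            ≈⟨ +-congˡ (-‿cong (1+× n 1#)) ⟨
    suc m × 1# - suc n × 1#               ∎

  ι-+ : ∀ i j → ι (i ℤ.+ j) ≈ ι i + ι j
  ι-+ (+ m)    (+ n)    = ×-homo-+ 1# m n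
  ι-+ (+ m)    -[1+ n ] = ι-⊖ m (suc n)
  ι-+ -[1+ m ] (+ n)    = trans (ι-⊖ n (suc m)) (+-comm _ _)
  ι-+ -[1+ m ] -[1+ n ] = begin
    - (suc (suc (m ℕ.+ n)) × 1#)       ≡⟨ ≡.cong (λ k → - (suc k × 1#)) (ℕ.+-suc m n) ⟨
    - ((suc m ℕ.+ suc n) × 1#)         ≈⟨ -‿cong (×-homo-+ 1# (suc m) (suc n)) ⟩
    - (suc m × 1# + suc n × 1#)        ≈⟨ -‿+-comm _ _ ⟨
    - (suc m × 1#) + - (suc n × 1#)    ∎

  private
    signed : Sign → Carrier → Carrier
    signed Sign.+ y = y
    signed Sign.- y = - y

    signed-cong : ∀ s {y z} → y ≈ z → signed s y ≈ signed s z
    signed-cong Sign.+ e = e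
    signed-cong Sign.- e = -‿cong e

    ι-◃ : ∀ s n → ι (s ℤ.◃ n) ≈ signed s (n × 1#)
    ι-◃ Sign.+ zero    = refl
    ι-◃ Sign.+ (suc n) = refl
    ι-◃ Sign.- zero    = sym -0#≈0#
    ι-◃ Sign.- (suc n) = refl

    ι-signed : ∀ i → ι i ≈ signed (ℤ.sign i) (ℤ.∣ i ∣ × 1#)
    ι-signed (+ n)    = refl
    ι-signed -[1+ n ] = refl

    signed-* : ∀ s t y z → signed (s Sign.* t) (y * z) ≈ signed s y * signed t z
    signed-* Sign.+ Sign.+ y z = refl
    signed-* Sign.+ Sign.- y z = -‿distribʳ-* y z
    signed-* Sign.- Sign.+ y z = -‿distribˡ-* y z
    signed-* Sign.- Sign.- y z = begin
      y * z           ≈⟨ -‿involutive _ ⟨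
      - - (y * z)     ≈⟨ -‿cong (-‿distribˡ-* y z) ⟩
      - (- y * z)     ≈⟨ -‿distribʳ-* (- y) z ⟩
      - y * - z       ∎

  ι-* : ∀ i j → ι (i ℤ.* j) ≈ ι i * ι j
  ι-* i j = begin
    ι (i ℤ.* j)                                            ≈⟨ ι-◃ (s Sign.* t) (ℤ.∣ i ∣ *ℕ ℤ.∣ j ∣) ⟩
    signed (s Sign.* t) ((ℤ.∣ i ∣ *ℕ ℤ.∣ j ∣) × 1#)      ≈⟨ signed-cong (s Sign.* t) (×1-homo-* ℤ.∣ i ∣ ℤ.∣ j ∣) ⟩
    signed (s Sign.* t) (ℤ.∣ i ∣ × 1# * ℤ.∣ j ∣ × 1#)     ≈⟨ signed-* s t _ _ ⟩
    signed s (ℤ.∣ i ∣ × 1#) * signed t (ℤ.∣ j ∣ × 1#)     ≈⟨ *-cong (ι-signed i) (ι-signed j) ⟨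
    ι i * ι j                                              ∎
    where
    s t : Sign
    s = ℤ.sign i
    t = ℤ.sign j

  ι-neg : ∀ i → ι (ℤ.- i) ≈ - ι i
  ι-neg (+ zero)  = sym -0#≈0#
  ι-neg (+ suc n) = refl
  ι-neg -[1+ n ]  = sym (-‿involutive _)

  ringWithIntegerCoefficients : AlmostCommutativeRing c ℓ
  ringWithIntegerCoefficients = fromCommutativeRing R

  ι-homomorphism : ℤ.+-*-rawRing -Raw-AlmostCommutative⟶ ringWithIntegerCoefficients
  ι-homomorphism = record
    { ⟦_⟧    = ι
    ; +-homo = ι-+
    ; *-homo = ι-*
    ; -‿homo = ι-neg
    ; 0-homo = refl
    ; 1-homo = refl
    }

  private
    ι-≟ : ∀ i j → Maybe (ι i ≈ ι j)
    ι-≟ i j with i ℤ.≟ j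
    ... | yes ≡.refl = just refl
    ... | no _       = nothing

  open RingSolver ℤ.+-*-rawRing ringWithIntegerCoefficients ι-homomorphism ι-≟
    public using (solve; _:=_; _:+_; _:-_; _:*_; :-_; con)

module Determinant {c ℓ : Level} (F : Field c ℓ) where
  open Field F hiding (zero)
  open IntegerCoefficients commutativeRing using (solve; _:=_; _:+_; _:-_; _:*_; :-_; con)
  open import Algebra.Properties.Ring ring using (-0#≈0#; -‿+-comm; -‿distribˡ-*)
  open import Relation.Binary.Reasoning.Setoid setoid

  private
    sum : (n : ℕ) → (Fin n → Carrier) → Carrier
    sum = sumFin F

    sign : ∀ {n} → Fin n → Carrier
    sign = signFin F

  sum-cong : ∀ n {f g : Fin n → Carrier} → (∀ j → f j ≈ g j) → sum n f ≈ sum n g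
  sum-cong zero    f≈g = refl
  sum-cong (suc n) f≈g = +-cong (f≈g fzero) (sum-cong n (λ j → f≈g (fsuc j)))

  sum-+ : ∀ n (f g : Fin n → Carrier) → sum n (λ j → f j + g j) ≈ sum n f + sum n g
  sum-+ zero    f g = sym (+-identityˡ 0#)
  sum-+ (suc n) f g = trans (+-congˡ (sum-+ n _ _))
    (solve 4 (λ p q r s → (p :+ q) :+ (r :+ s) := (p :+ r) :+ (q :+ s)) refl _ _ _ _)

  sum-*ˡ : ∀ n y (f : Fin n → Carrier) → sum n (λ j → y * f j) ≈ y * sum n f
  sum-*ˡ zero    y f = sym (zeroʳ y)
  sum-*ˡ (suc n) y f = trans (+-congˡ (sum-*ˡ n y _)) (sym (distribˡ _ _ _))

  sum-neg : ∀ n (f : Fin n → Carrier) → sum n (λ j → - f j) ≈ - sum n f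
  sum-neg zero    f = sym -0#≈0#
  sum-neg (suc n) f = trans (+-congˡ (sum-neg n _)) (-‿+-comm _ _)

  sum-≈0 : ∀ n (f : Fin n → Carrier) → (∀ j → f j ≈ 0#) → sum n f ≈ 0#
  sum-≈0 zero    f f≈0 = refl
  sum-≈0 (suc n) f f≈0 = trans (+-cong (f≈0 fzero) (sum-≈0 n _ (λ j → f≈0 (fsuc j)))) (+-identityˡ 0#)

  minor : ∀ {n} → Matrix F (suc n) → Fin (suc n) → Matrix F n
  minor M j a b = M (fsuc a) (punchIn j b)

  cofactorTerm : ∀ {n} → Matrix F (suc n) → Fin (suc n) → Carrier
  cofactorTerm {n} M j = sign j * (M fzero j * det F n (minor M j))

  det-cong : ∀ n {M N : Matrix F n} → (∀ i j → M i j ≈ N i j) → det F n M ≈ det F n N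
  det-cong zero    M≈N = refl
  det-cong (suc n) M≈N = sum-cong (suc n) λ j →
    *-congˡ {sign j} (*-cong (M≈N fzero j) (det-cong n (λ a b → M≈N (fsuc a) (punchIn j b))))

  private
    det-byCofactors : ∀ n (M A B : Matrix F (suc n)) κ →
                      (∀ j → cofactorTerm M j ≈ cofactorTerm A j + κ * cofactorTerm B j) →
                      det F (suc n) M ≈ det F (suc n) A + κ * det F (suc n) B
    det-byCofactors n M A B κ termwise = begin
      sum (suc n) (cofactorTerm M)                                         ≈⟨ sum-cong (suc n) termwise ⟩
      sum (suc n) (λ j → cofactorTerm A j + κ * cofactorTerm B j)          ≈⟨ sum-+ (suc n) (cofactorTerm A) (λ j → κ * cofactorTerm B j) ⟩
      det F (suc n) A + sum (suc n) (λ j → κ * cofactorTerm B j)           ≈⟨ +-congˡ (sum-*ˡ (suc n) κ (cofactorTerm B)) ⟩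
      det F (suc n) A + κ * det F (suc n) B                                ∎

  det-linear : ∀ n (r : Fin n) (M A B : Matrix F n) κ →
               (∀ i j → i ≢ r → A i j ≈ M i j) → (∀ i j → i ≢ r → B i j ≈ M i j) →
               (∀ j → M r j ≈ A r j + κ * B r j) →
               det F n M ≈ det F n A + κ * det F n B
  det-linear (suc n) fzero M A B κ A≈M B≈M Mr≈ = det-byCofactors n M A B κ λ j → begin
    sign j * (M fzero j * det F n (minor M j))                      ≈⟨ *-congˡ (*-cong (Mr≈ j) (det-cong n (λ a b → sym (A≈M _ _ λ ())))) ⟩
    sign j * ((A fzero j + κ * B fzero j) * det F n (minor A j))    ≈⟨ distribute (sign j) (A fzero j) (B fzero j) κ _ ⟩
    cofactorTerm A j + κ * (sign j * (B fzero j * det F n (minor A j)))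
      ≈⟨ +-congˡ (*-congˡ (*-congˡ (*-congˡ (det-cong n (λ a b → trans (A≈M _ _ λ ()) (sym (B≈M _ _ λ ()))))))) ⟩
    cofactorTerm A j + κ * cofactorTerm B j                          ∎
    where
    distribute : ∀ s a b κ d → s * ((a + κ * b) * d) ≈ s * (a * d) + κ * (s * (b * d))
    distribute = solve 5 (λ s a b κ d → s :* ((a :+ κ :* b) :* d) := s :* (a :* d) :+ κ :* (s :* (b :* d))) refl
  det-linear (suc n) (fsuc r) M A B κ A≈M B≈M Mr≈ = det-byCofactors n M A B κ λ j → begin
    sign j * (M fzero j * det F n (minor M j))
      ≈⟨ *-congˡ (*-cong (sym (A≈M fzero j λ ())) (det-linear n r (minor M j) (minor A j) (minor B j) κ
           (λ a b a≢r → A≈M _ _ (a≢r ∘ Fin.suc-injective)) (λ a b a≢r → B≈M _ _ (a≢r ∘ Fin.suc-injective))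
           (λ b → Mr≈ (punchIn j b)))) ⟩
    sign j * (A fzero j * (det F n (minor A j) + κ * det F n (minor B j)))   ≈⟨ distribute (sign j) (A fzero j) _ κ _ ⟩
    cofactorTerm A j + κ * (sign j * (A fzero j * det F n (minor B j)))
      ≈⟨ +-congˡ (*-congˡ (*-congˡ (*-congʳ (trans (A≈M fzero j λ ()) (sym (B≈M fzero j λ ())))))) ⟩
    cofactorTerm A j + κ * cofactorTerm B j                                  ∎
    where
    distribute : ∀ s a d κ e → s * (a * (d + κ * e)) ≈ s * (a * d) + κ * (s * (a * e))
    distribute = solve 5 (λ s a d κ e → s :* (a :* (d :+ κ :* e)) := s :* (a :* d) :+ κ :* (s :* (a :* e))) refl

  cofactor≈0ˡ : ∀ s {a} d → a ≈ 0# → s * (a * d) ≈ 0#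
  cofactor≈0ˡ s d a≈0 = trans (*-congˡ (trans (*-congʳ a≈0) (zeroˡ d))) (zeroʳ s)

  cofactor≈0ʳ : ∀ s a {d} → d ≈ 0# → s * (a * d) ≈ 0#
  cofactor≈0ʳ s a d≈0 = trans (*-congˡ (trans (*-congˡ d≈0) (zeroʳ a))) (zeroʳ s)

  det-firstColumn≈0 : ∀ n (M : Matrix F (suc n)) → (∀ i → M i fzero ≈ 0#) → det F (suc n) M ≈ 0#
  det-firstColumn≈0 n M col≈0 = sum-≈0 (suc n) (cofactorTerm M) (cofactor≈0 n M col≈0)
    where
    cofactor≈0 : ∀ n (M : Matrix F (suc n)) → (∀ i → M i fzero ≈ 0#) → ∀ j → cofactorTerm M j ≈ 0#
    cofactor≈0 n       M col≈0 fzero    = cofactor≈0ˡ (sign {suc n} fzero) _ (col≈0 fzero)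
    cofactor≈0 (suc n) M col≈0 (fsuc j) =
      cofactor≈0ʳ (sign (fsuc j)) _ (det-firstColumn≈0 n (minor M (fsuc j)) (λ a → col≈0 (fsuc a)))

  private
    Extensional : ∀ {m n} → ((Fin m → Fin n) → Carrier) → Set _
    Extensional G = ∀ σ τ → σ ≗ τ → G σ ≈ G τ

    -- The Laplace expansion along two rows that both equal a, with G the determinant of the remaining rows.
    twoRowExpansion : ∀ n → (Fin (suc (suc n)) → Carrier) → ((Fin n → Fin (suc (suc n))) → Carrier) → Carrier
    twoRowExpansion n a G = sum (suc (suc n)) λ j → sign j * (a j *
      sum (suc n) λ l → sign l * (a (punchIn j l) * G (punchIn j ∘ punchIn l)))

    -- Within twoRowExpansion the terms whose second chosen column is 0 cancel against those whose first is 0.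
    twoRowExpansion≈tail : ∀ n a G → twoRowExpansion n a G ≈
      - sum (suc n) (λ j → sign j * (a (fsuc j) *
          sum n λ l → sign (fsuc l) * (a (fsuc (punchIn j l)) * G (punchIn (fsuc j) ∘ punchIn (fsuc l)))))
    twoRowExpansion≈tail n a G = begin
      twoRowExpansion n a G
        ≡⟨⟩
      1# * (a fzero * X) + sum (suc n) (λ j → - sign j * (a (fsuc j) * (1# * (a fzero * Gᶠ j) + tail j)))
        ≈⟨ +-congˡ (sum-cong (suc n) λ j → split (sign j) (a (fsuc j)) (a fzero) (Gᶠ j) (tail j)) ⟩
      1# * (a fzero * X) + sum (suc n) (λ j → - a fzero * (sign j * (a (fsuc j) * Gᶠ j)) + - (sign j * (a (fsuc j) * tail j)))
        ≈⟨ +-congˡ (sum-+ (suc n) (λ j → - a fzero * (sign j * (a (fsuc j) * Gᶠ j))) (λ j → - (sign j * (a (fsuc j) * tail j)))) ⟩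
      1# * (a fzero * X) + (sum (suc n) (λ j → - a fzero * (sign j * (a (fsuc j) * Gᶠ j))) + sum (suc n) (λ j → - (sign j * (a (fsuc j) * tail j))))
        ≈⟨ +-congˡ (+-cong (sum-*ˡ (suc n) (- a fzero) (λ j → sign j * (a (fsuc j) * Gᶠ j))) (sum-neg (suc n) (λ j → sign j * (a (fsuc j) * tail j)))) ⟩
      1# * (a fzero * X) + (- a fzero * X + - sum (suc n) (λ j → sign j * (a (fsuc j) * tail j)))
        ≈⟨ cancel (a fzero) X _ ⟩
      - sum (suc n) (λ j → sign j * (a (fsuc j) * tail j)) ∎
      where
      Gᶠ : Fin (suc n) → Carrier
      Gᶠ j = G (fsuc ∘ punchIn j)
      X : Carrier
      X = sum (suc n) λ l → sign l * (a (fsuc l) * Gᶠ l)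
      tail : Fin (suc n) → Carrier
      tail j = sum n λ l → sign (fsuc l) * (a (fsuc (punchIn j l)) * G (punchIn (fsuc j) ∘ punchIn (fsuc l)))
      split : ∀ s b a₀ g t → - s * (b * (1# * (a₀ * g) + t)) ≈ - a₀ * (s * (b * g)) + - (s * (b * t))
      split = solve 5 (λ s b a₀ g t → (:- s) :* (b :* (con (+ 1) :* (a₀ :* g) :+ t))
                                    := (:- a₀) :* (s :* (b :* g)) :+ :- (s :* (b :* t))) refl
      cancel : ∀ a₀ x z → 1# * (a₀ * x) + (- a₀ * x + - z) ≈ - z
      cancel = solve 3 (λ a₀ x z → con (+ 1) :* (a₀ :* x) :+ ((:- a₀) :* x :+ :- z) := :- z) refl

    twoRowExpansion≈0 : ∀ n a G → Extensional G → twoRowExpansion n a G ≈ 0#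
    twoRowExpansion≈0 zero a G _ = begin
      twoRowExpansion zero a G                                ≈⟨ twoRowExpansion≈tail zero a G ⟩
      - sum 1 (λ j → sign j * (a (fsuc j) * 0#))
        ≈⟨ -‿cong (sum-≈0 1 (λ j → sign j * (a (fsuc j) * 0#)) λ j → cofactor≈0ʳ (sign j) _ refl) ⟩
      - 0#                                                    ≈⟨ -0#≈0# ⟩
      0#                                                      ∎
    twoRowExpansion≈0 (suc n) a G G-ext = begin
      twoRowExpansion (suc n) a G                             ≈⟨ twoRowExpansion≈tail (suc n) a G ⟩
      - sum (suc (suc n)) (λ j → sign j * (a (fsuc j) * tail j))   ≈⟨ sum-neg (suc (suc n)) (λ j → sign j * (a (fsuc j) * tail j)) ⟨
      sum (suc (suc n)) (λ j → - (sign j * (a (fsuc j) * tail j))) ≈⟨ sum-cong (suc (suc n)) shifted ⟩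
      twoRowExpansion n (a ∘ fsuc) (G ∘ Fin.lift 1)           ≈⟨ twoRowExpansion≈0 n (a ∘ fsuc) (G ∘ Fin.lift 1) lifted-ext ⟩
      0#                                                      ∎
      where
      tail : Fin (suc (suc n)) → Carrier
      tail j = sum (suc n) λ l → sign (fsuc l) * (a (fsuc (punchIn j l)) * G (punchIn (fsuc j) ∘ punchIn (fsuc l)))
      lifted-ext : Extensional (G ∘ Fin.lift 1)
      lifted-ext σ τ σ≗τ = G-ext _ _ λ { fzero → ≡.refl ; (fsuc b) → ≡.cong fsuc (σ≗τ b) }
      punchIn-lift : ∀ j l → punchIn (fsuc j) ∘ punchIn (fsuc l) ≗ Fin.lift 1 (punchIn j ∘ punchIn l)
      punchIn-lift j l fzero    = ≡.refl
      punchIn-lift j l (fsuc b) = ≡.refl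
      negate-twice : ∀ s b w → - (s * (b * - w)) ≈ s * (b * w)
      negate-twice = solve 3 (λ s b w → :- (s :* (b :* (:- w))) := s :* (b :* w)) refl
      shifted : ∀ j → - (sign j * (a (fsuc j) * tail j)) ≈
        sign j * (a (fsuc j) * sum (suc n) λ l → sign l * (a (fsuc (punchIn j l)) * G (Fin.lift 1 (punchIn j ∘ punchIn l))))
      shifted j = begin
        - (sign j * (a (fsuc j) * tail j))
          ≈⟨ -‿cong (*-congˡ (*-congˡ (sum-cong (suc n) λ l → -‿distribˡ-* (sign l) (rest l)))) ⟨
        - (sign j * (a (fsuc j) * sum (suc n) λ l → - (sign l * rest l)))
          ≈⟨ -‿cong (*-congˡ (*-congˡ (sum-neg (suc n) λ l → sign l * rest l))) ⟩
        - (sign j * (a (fsuc j) * - sum (suc n) λ l → sign l * rest l))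
          ≈⟨ negate-twice (sign j) (a (fsuc j)) _ ⟩
        sign j * (a (fsuc j) * sum (suc n) λ l → sign l * rest l)
          ≈⟨ *-congˡ (*-congˡ (sum-cong (suc n) λ l → *-congˡ {sign l} (*-congˡ {a (fsuc (punchIn j l))}
               (G-ext _ (Fin.lift 1 (punchIn j ∘ punchIn l)) (punchIn-lift j l))))) ⟩
        sign j * (a (fsuc j) * sum (suc n) λ l → sign l * (a (fsuc (punchIn j l)) * G (Fin.lift 1 (punchIn j ∘ punchIn l)))) ∎
        where
        rest : Fin (suc n) → Carrier
        rest l = a (fsuc (punchIn j l)) * G (punchIn (fsuc j) ∘ punchIn (fsuc l))

  det-equalAdjacentRows : ∀ n (M : Matrix F (suc (suc n))) (r : Fin (suc n)) →
                          (∀ j → M (inject₁ r) j ≈ M (fsuc r) j) → det F (suc (suc n)) M ≈ 0#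
  det-equalAdjacentRows n M fzero rows≈ = trans (sum-cong (suc (suc n)) secondRow≈first)
    (twoRowExpansion≈0 n (M fzero) G λ σ τ σ≗τ → det-cong n λ a b → reflexive (≡.cong (M (fsuc (fsuc a))) (σ≗τ b)))
    where
    G : (Fin n → Fin (suc (suc n))) → Carrier
    G σ = det F n λ a b → M (fsuc (fsuc a)) (σ b)
    secondRow≈first : ∀ j → cofactorTerm M j ≈
      sign j * (M fzero j * sum (suc n) λ l → sign l * (M fzero (punchIn j l) * G (punchIn j ∘ punchIn l)))
    secondRow≈first j = *-congˡ (*-congˡ (sum-cong (suc n) λ l → *-congˡ {sign l} (*-congʳ {det F n (minor (minor M j) l)} (sym (rows≈ (punchIn j l))))))
  det-equalAdjacentRows (suc n) M (fsuc r) rows≈ = sum-≈0 (suc (suc (suc n))) (cofactorTerm M) λ j →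
    cofactor≈0ʳ (sign j) (M fzero j) (det-equalAdjacentRows n (minor M j) r λ b → rows≈ (punchIn j b))

module RowReduction {c ℓ : Level} (F : Field c ℓ) where
  open Field F hiding (zero)
  open Determinant F
  open IntegerCoefficients commutativeRing using (solve; _:=_; _:+_; _:-_; con)
  open import Algebra.Properties.Ring ring using (-1*x≈-x; -0#≈0#)
  open import Relation.Binary.Reasoning.Setoid setoid

  toMatrix : ∀ n → (ℕ → ℕ → Carrier) → Matrix F n
  toMatrix n f i j = f (toℕ i) (toℕ j)

  det-congℕ : ∀ n {f g : ℕ → ℕ → Carrier} → (∀ r c → r < n → c < n → f r c ≈ g r c) →
              det F n (toMatrix n f) ≈ det F n (toMatrix n g)
  det-congℕ n f≈g = det-cong n λ i j → f≈g (toℕ i) (toℕ j) (Fin.toℕ<n i) (Fin.toℕ<n j)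

  replaceRow : (ℕ → ℕ → Carrier) → ℕ → ℕ → ℕ → ℕ → Carrier
  replaceRow f t s r = if ⌊ r ≟ t ⌋ then f s else f r

  det-addRow : ∀ n (f g : ℕ → ℕ → Carrier) t s κ → t < n →
               det F n (toMatrix n (replaceRow f t s)) ≈ 0# →
               (∀ r c → r ≢ t → g r c ≈ f r c) → (∀ c → g t c ≈ f t c + κ * f s c) →
               det F n (toMatrix n g) ≈ det F n (toMatrix n f)
  det-addRow n f g t s κ t<n replaced≈0 g≈f gₜ≈ = begin
    det F n (toMatrix n g)
      ≈⟨ det-linear n R (toMatrix n g) (toMatrix n f) (toMatrix n (replaceRow f t s)) κ f≈g replaced≈g gR≈ ⟩
    det F n (toMatrix n f) + κ * det F n (toMatrix n (replaceRow f t s))         ≈⟨ +-congˡ (trans (*-congˡ replaced≈0) (zeroʳ κ)) ⟩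
    det F n (toMatrix n f) + 0#                                                   ≈⟨ +-identityʳ _ ⟩
    det F n (toMatrix n f)                                                        ∎
    where
    R : Fin n
    R = fromℕ< t<n
    off-t : ∀ i → i ≢ R → toℕ i ≢ t
    off-t i i≢R i≡t = i≢R (Fin.toℕ-injective (≡.trans i≡t (≡.sym (Fin.toℕ-fromℕ< t<n))))
    f≈g : ∀ i j → i ≢ R → f (toℕ i) (toℕ j) ≈ g (toℕ i) (toℕ j)
    f≈g i j i≢R = sym (g≈f _ _ (off-t i i≢R))
    replaced≈g : ∀ i j → i ≢ R → replaceRow f t s (toℕ i) (toℕ j) ≈ g (toℕ i) (toℕ j)
    replaced≈g i j i≢R = trans (reflexive (≡.cong-app (if⌊≟⌋-≢ (f s) (f (toℕ i)) (off-t i i≢R)) (toℕ j))) (f≈g i j i≢R)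
    gR≈ : ∀ j → g (toℕ R) (toℕ j) ≈ f (toℕ R) (toℕ j) + κ * replaceRow f t s (toℕ R) (toℕ j)
    gR≈ j rewrite Fin.toℕ-fromℕ< t<n | if⌊≟⌋-refl t (f s) (f t) = gₜ≈ (toℕ j)

  det-equalAdjacentRowsℕ : ∀ m (f : ℕ → ℕ → Carrier) t → t < suc m → (∀ c → f t c ≈ f (suc t) c) →
                           det F (suc (suc m)) (toMatrix (suc (suc m)) f) ≈ 0#
  det-equalAdjacentRowsℕ m f t t<1+m rows≈ = det-equalAdjacentRows m (toMatrix _ f) R λ j →
    ≡.subst₂ (λ u v → f u (toℕ j) ≈ f (suc v) (toℕ j)) (≡.sym toℕ-inject₁R) (≡.sym (Fin.toℕ-fromℕ< t<1+m)) (rows≈ (toℕ j))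
    where
    R : Fin (suc m)
    R = fromℕ< t<1+m
    toℕ-inject₁R : toℕ (inject₁ R) ≡ t
    toℕ-inject₁R = ≡.trans (Fin.toℕ-inject₁ R) (Fin.toℕ-fromℕ< t<1+m)

  det-addNextRow : ∀ m (f g : ℕ → ℕ → Carrier) t κ → t < suc m →
                   (∀ r c → r ≢ t → g r c ≈ f r c) → (∀ c → g t c ≈ f t c + κ * f (suc t) c) →
                   det F (suc (suc m)) (toMatrix _ g) ≈ det F (suc (suc m)) (toMatrix _ f)
  det-addNextRow m f g t κ t<1+m = det-addRow _ f g t (suc t) κ (ℕ.m<n⇒m<1+n t<1+m)
    (det-equalAdjacentRowsℕ m (replaceRow f t (suc t)) t t<1+m λ c →
      reflexive (≡.cong-app (≡.trans (if⌊≟⌋-refl t (f (suc t)) (f t)) (≡.sym (if⌊≟⌋-≢ (f (suc t)) (f (suc t)) ℕ.1+n≢n))) c))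

  det-addPreviousRow : ∀ m (f g : ℕ → ℕ → Carrier) t κ → t < suc m →
                       (∀ r c → r ≢ suc t → g r c ≈ f r c) → (∀ c → g (suc t) c ≈ f (suc t) c + κ * f t c) →
                       det F (suc (suc m)) (toMatrix _ g) ≈ det F (suc (suc m)) (toMatrix _ f)
  det-addPreviousRow m f g t κ t<1+m = det-addRow _ f g (suc t) t κ (s≤s t<1+m)
    (det-equalAdjacentRowsℕ m (replaceRow f (suc t) t) t t<1+m λ c →
      reflexive (≡.cong-app (≡.trans (if⌊≟⌋-≢ (f t) (f t) (ℕ.<⇒≢ (ℕ.n<1+n t))) (≡.sym (if⌊≟⌋-refl (suc t) (f t) (f (suc t))))) c))

  subtractNextRows : (ℕ → ℕ → Carrier) → ℕ → ℕ → ℕ → Carrier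
  subtractNextRows f t r c = if ⌊ r <? t ⌋ then f r c - f (suc r) c else f r c

  -- Only used with t ≥ 1, so pred r is always the row above r.
  addPreviousRows : (ℕ → ℕ → Carrier) → ℕ → ℕ → ℕ → Carrier
  addPreviousRows f t r c = if ⌊ r <? t ⌋ then f r c else f r c + f (pred r) c

  det-subtractNextRows : ∀ m f t → t ≤ suc m →
    det F (suc (suc m)) (toMatrix _ (subtractNextRows f t)) ≈ det F (suc (suc m)) (toMatrix _ f)
  det-subtractNextRows m f zero _ = det-congℕ (suc (suc m)) {subtractNextRows f zero} {f} λ r c _ _ →
    reflexive (if⌊<?⌋-≥ {r = r} {0} (f r c - f (suc r) c) (f r c) z≤n)
  det-subtractNextRows m f (suc t) t<1+m = trans
    (det-addNextRow m (subtractNextRows f t) (subtractNextRows f (suc t)) t (- 1#) t<1+m unchanged rowₜ)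
    (det-subtractNextRows m f t (ℕ.<⇒≤ t<1+m))
    where
    unchanged : ∀ r c → r ≢ t → subtractNextRows f (suc t) r c ≈ subtractNextRows f t r c
    unchanged r c r≢t with ℕ.<-cmp r t
    ... | tri< r<t _ _ = reflexive (≡.trans (if⌊<?⌋-< _ _ (ℕ.m<n⇒m<1+n r<t)) (≡.sym (if⌊<?⌋-< _ _ r<t)))
    ... | tri≈ _ r≡t _ = contradiction r≡t r≢t
    ... | tri> _ _ t<r = reflexive (≡.trans (if⌊<?⌋-≥ _ _ t<r) (≡.sym (if⌊<?⌋-≥ _ _ (ℕ.<⇒≤ t<r))))
    rowₜ : ∀ c → subtractNextRows f (suc t) t c ≈ subtractNextRows f t t c + - 1# * subtractNextRows f t (suc t) c
    rowₜ c = begin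
      subtractNextRows f (suc t) t c            ≡⟨ if⌊<?⌋-< _ _ (ℕ.n<1+n t) ⟩
      f t c - f (suc t) c                       ≈⟨ +-congˡ (-1*x≈-x _) ⟨
      f t c + - 1# * f (suc t) c
        ≡⟨ ≡.cong₂ (λ u v → u + - 1# * v) (if⌊<?⌋-≥ {r = t} {t} _ (f t c) ℕ.≤-refl)
                                          (if⌊<?⌋-≥ {r = suc t} {t} _ (f (suc t) c) (ℕ.n≤1+n t)) ⟨
      subtractNextRows f t t c + - 1# * subtractNextRows f t (suc t) c ∎

  -- Induction on d runs downwards in p: rows are added from the bottom up.
  det-addPreviousRows : ∀ m f d p → p ℕ.+ d ≡ suc m →
    det F (suc (suc m)) (toMatrix _ (addPreviousRows f (suc p))) ≈ det F (suc (suc m)) (toMatrix _ f)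
  det-addPreviousRows m f zero p p+0≡1+m = det-congℕ (suc (suc m)) {addPreviousRows f (suc p)} {f} λ r c r<2+m _ →
    reflexive (if⌊<?⌋-< _ _ (≡.subst (λ n → r < suc n) (≡.trans (≡.sym p+0≡1+m) (ℕ.+-identityʳ p)) r<2+m))
  det-addPreviousRows m f (suc d) p p+1+d≡1+m = trans
    (det-addPreviousRow m (addPreviousRows f (suc (suc p))) (addPreviousRows f (suc p)) p 1# p<1+m unchanged rowₚ₊₁)
    (det-addPreviousRows m f d (suc p) (≡.trans (≡.sym (ℕ.+-suc p d)) p+1+d≡1+m))
    where
    p<1+m : p < suc m
    p<1+m = ≡.subst (p <_) p+1+d≡1+m (ℕ.m<m+n p (s≤s z≤n))
    unchanged : ∀ r c → r ≢ suc p → addPreviousRows f (suc p) r c ≈ addPreviousRows f (suc (suc p)) r c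
    unchanged r c r≢1+p with ℕ.<-cmp r (suc p)
    ... | tri< r<1+p _ _ = reflexive (≡.trans (if⌊<?⌋-< _ _ r<1+p) (≡.sym (if⌊<?⌋-< _ _ (ℕ.m<n⇒m<1+n r<1+p))))
    ... | tri≈ _ r≡1+p _ = contradiction r≡1+p r≢1+p
    ... | tri> _ _ 1+p<r = reflexive (≡.trans (if⌊<?⌋-≥ _ _ (ℕ.<⇒≤ 1+p<r)) (≡.sym (if⌊<?⌋-≥ _ _ 1+p<r)))
    rowₚ₊₁ : ∀ c → addPreviousRows f (suc p) (suc p) c ≈
                   addPreviousRows f (suc (suc p)) (suc p) c + 1# * addPreviousRows f (suc (suc p)) p c
    rowₚ₊₁ c = begin
      addPreviousRows f (suc p) (suc p) c      ≡⟨ if⌊<?⌋-≥ {r = suc p} {suc p} (f (suc p) c) _ ℕ.≤-refl ⟩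
      f (suc p) c + f p c                      ≈⟨ +-congˡ (*-identityˡ _) ⟨
      f (suc p) c + 1# * f p c
        ≡⟨ ≡.cong₂ (λ u v → u + 1# * v) (if⌊<?⌋-< _ _ (ℕ.n<1+n (suc p))) (if⌊<?⌋-< _ _ (ℕ.m<n⇒m<1+n (ℕ.n<1+n p))) ⟨
      addPreviousRows f (suc (suc p)) (suc p) c + 1# * addPreviousRows f (suc (suc p)) p c ∎

  rowDifferences : (ℕ → ℕ → Carrier) → ℕ → ℕ → Carrier
  rowDifferences f zero    c = f 0 c - f 1 c
  rowDifferences f (suc r) c = f r c - f (suc (suc r)) c

  private
    swept≈rowDifferences : ∀ m f → (∀ c → c < suc (suc m) → f (suc (suc m)) c ≈ 0#) →
      ∀ r c → r < suc (suc m) → c < suc (suc m) → addPreviousRows (subtractNextRows f (suc m)) 1 r c ≈ rowDifferences f r c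
    swept≈rowDifferences m f _ zero c _ _ =
      reflexive (≡.trans (if⌊<?⌋-< {r = 0} {1} _ (f 0 c) (s≤s z≤n)) (if⌊<?⌋-< {r = 0} {suc m} _ (f 0 c) (s≤s z≤n)))
    swept≈rowDifferences m f rowₙ≈0 (suc r) c r<1+m c<2+m = begin
      addPreviousRows (subtractNextRows f (suc m)) 1 (suc r) c
        ≡⟨ if⌊<?⌋-≥ {r = suc r} {1} (subtractNextRows f (suc m) (suc r) c) _ (s≤s z≤n) ⟩
      subtractNextRows f (suc m) (suc r) c + subtractNextRows f (suc m) r c
        ≡⟨ ≡.cong (λ y → subtractNextRows f (suc m) (suc r) c + y) (if⌊<?⌋-< {r = r} {suc m} _ (f r c) (ℕ.s<s⁻¹ r<1+m)) ⟩
      subtractNextRows f (suc m) (suc r) c + (f r c - f (suc r) c)                   ≈⟨ interiorOrLast (ℕ.<-cmp r m) ⟩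
      f r c - f (suc (suc r)) c                                                      ∎
      where
      telescope : ∀ x y z → (y - z) + (x - y) ≈ x - z
      telescope = solve 3 (λ x y z → (y :- z) :+ (x :- y) := x :- z) refl
      interiorOrLast : Tri (r < m) (r ≡ m) (m < r) →
                subtractNextRows f (suc m) (suc r) c + (f r c - f (suc r) c) ≈ f r c - f (suc (suc r)) c
      interiorOrLast (tri< r<m _ _) = trans (+-congʳ (reflexive (if⌊<?⌋-< {r = suc r} {suc m} _ (f (suc r) c) (s≤s r<m)))) (telescope _ _ _)
      interiorOrLast (tri≈ _ ≡.refl _) = begin
        subtractNextRows f (suc r) (suc r) c + (f r c - f (suc r) c)
          ≡⟨ ≡.cong (λ y → y + (f r c - f (suc r) c)) (if⌊<?⌋-≥ {r = suc r} {suc r} _ (f (suc r) c) ℕ.≤-refl) ⟩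
        f (suc r) c + (f r c - f (suc r) c)                            ≈⟨ solve 2 (λ x y → y :+ (x :- y) := x :- con (+ 0)) refl (f r c) (f (suc r) c) ⟩
        f r c - 0#                                                     ≈⟨ +-congˡ (-‿cong (rowₙ≈0 c c<2+m)) ⟨
        f r c - f (suc (suc r)) c                                      ∎
      interiorOrLast (tri> _ _ m<r) = contradiction (ℕ.s≤s⁻¹ (ℕ.s<s⁻¹ r<1+m)) (ℕ.<⇒≱ m<r)

  -- The hypothesis says that the row just below the matrix vanishes on it, so the last row fits the pattern.
  det-rowDifferences : ∀ n f → (∀ c → c < n → f n c ≈ 0#) →
                       det F n (toMatrix n f) ≈ det F n (toMatrix n (rowDifferences f))
  det-rowDifferences zero f _ = refl
  det-rowDifferences (suc zero) f row₁≈0 = det-congℕ 1 {f} {rowDifferences f} λ where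
    zero c _ c<1 → begin
      f 0 c          ≈⟨ +-identityʳ _ ⟨
      f 0 c + 0#     ≈⟨ +-congˡ -0#≈0# ⟨
      f 0 c - 0#     ≈⟨ +-congˡ (-‿cong (row₁≈0 c c<1)) ⟨
      f 0 c - f 1 c  ∎
    (suc r) c (s≤s ()) _
  det-rowDifferences (suc (suc m)) f rowₙ≈0 = begin
    det F (suc (suc m)) (toMatrix _ f)                                         ≈⟨ det-subtractNextRows m f (suc m) ℕ.≤-refl ⟨
    det F (suc (suc m)) (toMatrix _ (subtractNextRows f (suc m)))                ≈⟨ det-addPreviousRows m (subtractNextRows f (suc m)) (suc m) 0 ≡.refl ⟨
    det F (suc (suc m)) (toMatrix _ (addPreviousRows (subtractNextRows f (suc m)) 1))
      ≈⟨ det-congℕ (suc (suc m)) (swept≈rowDifferences m f rowₙ≈0) ⟩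
    det F (suc (suc m)) (toMatrix _ (rowDifferences f))                         ∎

module Tridiagonal {c ℓ : Level} (F : Field c ℓ) where
  open Field F hiding (zero)
  open Determinant F
  open RowReduction F using (toMatrix)
  open IntegerCoefficients commutativeRing using (solve; _:=_; _:+_; _:-_; _:*_; :-_; con)
  open import Relation.Binary.Reasoning.Setoid setoid

  -- a on the diagonal, b above it and c below it, each indexed by its row. The (suc r) (suc s) clause
  -- precedes the (suc _) zero ones, so that it also holds definitionally when r is a variable.
  tridiagonal : (a b c : ℕ → Carrier) → ℕ → ℕ → Carrier
  tridiagonal a b c zero          zero          = a 0
  tridiagonal a b c zero          (suc zero)    = b 0
  tridiagonal a b c zero          (suc (suc _)) = 0#
  tridiagonal a b c (suc r)       (suc s)       = tridiagonal (a ∘ suc) (b ∘ suc) (c ∘ suc) r s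
  tridiagonal a b c (suc zero)    zero          = c 1
  tridiagonal a b c (suc (suc _)) zero          = 0#

  private
    -- Not definitional: ℕ._≟_ wraps different evidence around the same Boolean.
    ⌊suc≟suc⌋ : ∀ m n → ⌊ suc m ≟ suc n ⌋ ≡ ⌊ m ≟ n ⌋
    ⌊suc≟suc⌋ m n = ≡.trans (⌊⌋-map′ _ _ (T? (m ℕ.≡ᵇ n))) (≡.sym (⌊⌋-map′ _ _ (T? (m ℕ.≡ᵇ n))))

    tridiagEntry : Carrier → Bool → Bool → Bool → Carrier
    tridiagEntry d onDiagonal above below =
      if onDiagonal then d else if above then - 1# else if below then 1# else 0#

  tridiag≡tridiagonal : ∀ {n} β (i j : Fin n) →
    tridiag F n β i j ≡ tridiagonal (β ∘ suc) (λ _ → - 1#) (λ _ → 1#) (toℕ i) (toℕ j)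
  tridiag≡tridiagonal β fzero           fzero           = ≡.refl
  tridiag≡tridiagonal β fzero           (fsuc fzero)    = ≡.refl
  tridiag≡tridiagonal β fzero           (fsuc (fsuc j)) = ≡.refl
  tridiag≡tridiagonal β (fsuc fzero)    fzero           = ≡.refl
  tridiag≡tridiagonal β (fsuc (fsuc i)) fzero           = ≡.refl
  tridiag≡tridiagonal β (fsuc i)        (fsuc j)        = ≡.trans
    (≡.trans (≡.cong₂ (λ p q → tridiagEntry d p q ⌊ suc r ≟ suc (suc s) ⌋) (⌊suc≟suc⌋ r s) (⌊suc≟suc⌋ (suc r) s))
             (≡.cong (tridiagEntry d ⌊ r ≟ s ⌋ ⌊ suc r ≟ s ⌋) (⌊suc≟suc⌋ r (suc s))))
    (tridiag≡tridiagonal (β ∘ suc) i j)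
    where
    r s : ℕ
    r = toℕ i
    s = toℕ j
    d : Carrier
    d = β (suc (suc r))

  T≈det-tridiagonal : ∀ n β → T F n β ≈ det F n (toMatrix n (tridiagonal (β ∘ suc) (λ _ → - 1#) (λ _ → 1#)))
  T≈det-tridiagonal n β = det-cong n λ i j → reflexive (tridiag≡tridiagonal β i j)

  det-tridiagonal-recurrence : ∀ m a b c →
    det F (suc (suc m)) (toMatrix _ (tridiagonal a b c)) ≈
      a 0 * det F (suc m) (toMatrix _ (tridiagonal (a ∘ suc) (b ∘ suc) (c ∘ suc)))
      - b 0 * c 1 * det F m (toMatrix m (tridiagonal (a ∘ suc ∘ suc) (b ∘ suc ∘ suc) (c ∘ suc ∘ suc)))
  det-tridiagonal-recurrence m a b c = collect (a 0) _ (b 0) (c 1) _ (belowSecondEntry m M λ _ → refl) laterColumns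
    where
    M : Matrix F (suc (suc m))
    M = toMatrix _ (tridiagonal a b c)
    -- Expanding along the first row leaves the columns 0 and 1, and the minor of column 1 is expanded again.
    collect : ∀ a₀ d₁ b₀ c₁ d₂ {z₁ z₂} → z₁ ≈ 0# → z₂ ≈ 0# →
              1# * (a₀ * d₁) + (- 1# * (b₀ * (1# * (c₁ * d₂) + z₁)) + z₂) ≈ a₀ * d₁ - b₀ * c₁ * d₂
    collect a₀ d₁ b₀ c₁ d₂ {z₁} {z₂} z₁≈0 z₂≈0 = begin
      1# * (a₀ * d₁) + (- 1# * (b₀ * (1# * (c₁ * d₂) + z₁)) + z₂)   ≈⟨ +-congˡ (+-cong (*-congˡ (*-congˡ (+-congˡ z₁≈0))) z₂≈0) ⟩
      1# * (a₀ * d₁) + (- 1# * (b₀ * (1# * (c₁ * d₂) + 0#)) + 0#)   ≈⟨ solve 5 (λ a₀ d₁ b₀ c₁ d₂ →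
          con (+ 1) :* (a₀ :* d₁) :+ ((:- con (+ 1)) :* (b₀ :* (con (+ 1) :* (c₁ :* d₂) :+ con (+ 0))) :+ con (+ 0))
          := a₀ :* d₁ :- b₀ :* c₁ :* d₂) refl a₀ d₁ b₀ c₁ d₂ ⟩
      a₀ * d₁ - b₀ * c₁ * d₂                                        ∎
    belowSecondEntry : ∀ m (N : Matrix F (suc (suc m))) → (∀ i → N (fsuc (fsuc i)) fzero ≈ 0#) →
      sumFin F m (λ j → cofactorTerm (minor N (fsuc fzero)) (fsuc j)) ≈ 0#
    belowSecondEntry zero    N column≈0 = refl
    belowSecondEntry (suc m) N column≈0 = sum-≈0 (suc m) _ λ j →
      cofactor≈0ʳ (signFin F (fsuc j)) (minor N (fsuc fzero) fzero (fsuc j))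
        (det-firstColumn≈0 m (minor (minor N (fsuc fzero)) (fsuc j)) column≈0)
    laterColumns : sumFin F m (λ j → cofactorTerm M (fsuc (fsuc j))) ≈ 0#
    laterColumns = sum-≈0 m _ λ j → cofactor≈0ˡ (signFin F (fsuc (fsuc j))) _ refl

  prodFrom1-cons : ∀ n w → prodFrom1 F (suc n) w ≈ w 1 * prodFrom1 F n (w ∘ suc)
  prodFrom1-cons zero    w = trans (*-identityˡ (w 1)) (sym (*-identityʳ (w 1)))
  prodFrom1-cons (suc n) w = begin
    prodFrom1 F (suc n) w * w (suc (suc n))                ≈⟨ *-congʳ (prodFrom1-cons n w) ⟩
    (w 1 * prodFrom1 F n (w ∘ suc)) * w (suc (suc n))      ≈⟨ *-assoc _ _ _ ⟩
    w 1 * (prodFrom1 F n (w ∘ suc) * w (suc (suc n)))      ∎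

  det-tridiagonal-1 : ∀ a b c → det F 1 (toMatrix 1 (tridiagonal a b c)) ≈ a 0
  det-tridiagonal-1 a b c = trans (+-identityʳ _) (trans (*-identityˡ _) (*-identityʳ _))

  -- Row r of the left matrix is w (r + 1) times row r of the right one, up to the off-diagonal pairs,
  -- which enter the determinant only through the products b r * c (r + 1).
  det-tridiagonal-scale : ∀ n (a b c a′ b′ c′ w : ℕ → Carrier) →
    (∀ r → r < n → a r ≈ w (suc r) * a′ r) →
    (∀ r → suc r < n → b r * c (suc r) ≈ w (suc r) * w (suc (suc r)) * (b′ r * c′ (suc r))) →
    det F n (toMatrix n (tridiagonal a b c)) ≈ prodFrom1 F n w * det F n (toMatrix n (tridiagonal a′ b′ c′))
  det-tridiagonal-scale zero _ _ _ _ _ _ _ _ _ = sym (*-identityˡ 1#)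
  det-tridiagonal-scale (suc zero) a b c a′ b′ c′ w a≈ _ = begin
    det F 1 (toMatrix 1 (tridiagonal a b c))                 ≈⟨ det-tridiagonal-1 a b c ⟩
    a 0                                                      ≈⟨ a≈ 0 (s≤s z≤n) ⟩
    w 1 * a′ 0                                               ≈⟨ *-cong (*-identityˡ (w 1)) (det-tridiagonal-1 a′ b′ c′) ⟨
    (1# * w 1) * det F 1 (toMatrix 1 (tridiagonal a′ b′ c′)) ∎
  det-tridiagonal-scale (suc (suc m)) a b c a′ b′ c′ w a≈ bc≈ = begin
    det F (suc (suc m)) (toMatrix _ (tridiagonal a b c))     ≈⟨ det-tridiagonal-recurrence m a b c ⟩
    a 0 * d₁ - b 0 * c 1 * d₂
      ≈⟨ +-cong (*-cong (a≈ 0 (s≤s z≤n)) (trans (det-tridiagonal-scale (suc m) _ _ _ _ _ _ (w ∘ suc)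
                  (λ r r<1+m → a≈ (suc r) (s≤s r<1+m)) (λ r r<1+m → bc≈ (suc r) (s≤s r<1+m)))
                  (*-congʳ (prodFrom1-cons m (w ∘ suc)))))
                (-‿cong (*-cong (bc≈ 0 (s≤s (s≤s z≤n))) (det-tridiagonal-scale m _ _ _ _ _ _ (w ∘ suc ∘ suc)
                  (λ r r<m → a≈ (suc (suc r)) (s≤s (s≤s r<m))) (λ r r<m → bc≈ (suc (suc r)) (s≤s (s≤s r<m)))))) ⟩
    (w 1 * a′ 0) * ((w 2 * p) * d₁′) - (w 1 * w 2 * (b′ 0 * c′ 1)) * (p * d₂′)
      ≈⟨ factor (w 1) (w 2) p (a′ 0) d₁′ (b′ 0 * c′ 1) d₂′ ⟩
    (w 1 * (w 2 * p)) * (a′ 0 * d₁′ - b′ 0 * c′ 1 * d₂′)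
      ≈⟨ *-cong (trans (prodFrom1-cons (suc m) w) (*-congˡ (prodFrom1-cons m (w ∘ suc)))) (det-tridiagonal-recurrence m a′ b′ c′) ⟨
    prodFrom1 F (suc (suc m)) w * det F (suc (suc m)) (toMatrix _ (tridiagonal a′ b′ c′)) ∎
    where
    p d₁ d₁′ d₂ d₂′ : Carrier
    p = prodFrom1 F m (w ∘ suc ∘ suc)
    d₁  = det F (suc m) (toMatrix _ (tridiagonal (a ∘ suc) (b ∘ suc) (c ∘ suc)))
    d₁′ = det F (suc m) (toMatrix _ (tridiagonal (a′ ∘ suc) (b′ ∘ suc) (c′ ∘ suc)))
    d₂  = det F m (toMatrix m (tridiagonal (a ∘ suc ∘ suc) (b ∘ suc ∘ suc) (c ∘ suc ∘ suc)))
    d₂′ = det F m (toMatrix m (tridiagonal (a′ ∘ suc ∘ suc) (b′ ∘ suc ∘ suc) (c′ ∘ suc ∘ suc)))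
    factor : ∀ w₁ w₂ p a d₁ x d₂ → (w₁ * a) * ((w₂ * p) * d₁) - (w₁ * w₂ * x) * (p * d₂) ≈ (w₁ * (w₂ * p)) * (a * d₁ - x * d₂)
    factor = solve 7 (λ w₁ w₂ p a d₁ x d₂ →
      (w₁ :* a) :* ((w₂ :* p) :* d₁) :- (w₁ :* w₂ :* x) :* (p :* d₂) := (w₁ :* (w₂ :* p)) :* (a :* d₁ :- x :* d₂)) refl

  tridiagonal-diagonal : ∀ a b c r → tridiagonal a b c r r ≡ a r
  tridiagonal-diagonal a b c zero    = ≡.refl
  tridiagonal-diagonal a b c (suc r) = tridiagonal-diagonal (a ∘ suc) (b ∘ suc) (c ∘ suc) r

  tridiagonal-above : ∀ a b c r → tridiagonal a b c r (suc r) ≡ b r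
  tridiagonal-above a b c zero    = ≡.refl
  tridiagonal-above a b c (suc r) = tridiagonal-above (a ∘ suc) (b ∘ suc) (c ∘ suc) r

  tridiagonal-below : ∀ a b c r → tridiagonal a b c (suc r) r ≡ c (suc r)
  tridiagonal-below a b c zero    = ≡.refl
  tridiagonal-below a b c (suc r) = tridiagonal-below (a ∘ suc) (b ∘ suc) (c ∘ suc) r

  tridiagonal-farAbove : ∀ a b c r s → suc r < s → tridiagonal a b c r s ≡ 0#
  tridiagonal-farAbove a b c zero    (suc zero)    (s≤s ())
  tridiagonal-farAbove a b c zero    (suc (suc s)) _         = ≡.refl
  tridiagonal-farAbove a b c (suc r) (suc s)       (s≤s r<s) = tridiagonal-farAbove (a ∘ suc) (b ∘ suc) (c ∘ suc) r s r<s

  tridiagonal-farBelow : ∀ a b c r s → suc s < r → tridiagonal a b c r s ≡ 0#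
  tridiagonal-farBelow a b c (suc zero)    zero    (s≤s ())
  tridiagonal-farBelow a b c (suc (suc r)) zero    _         = ≡.refl
  tridiagonal-farBelow a b c (suc r)       (suc s) (s≤s s<r) = tridiagonal-farBelow (a ∘ suc) (b ∘ suc) (c ∘ suc) r s s<r

module QuotientMatrix {c ℓ : Level} (F : Field c ℓ) (α : ℕ → ℕ) (x : Field.Carrier F) where
  open Field F hiding (zero)
  open RowReduction F using (toMatrix; rowDifferences)
  open Tridiagonal F
  open IntegerCoefficients commutativeRing using (solve; _:=_; _:+_; _:-_; _:*_; :-_; con)
  open import Relation.Binary.Reasoning.Setoid setoid

  -- Rows and columns are numbered from 0, so row r is the class C_{r+1}; it is an odd class iff r is even.
  a : ℕ → Carrier
  a r = fromℕ F (α (suc r))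

  entry : ℕ → ℕ → Carrier
  entry r s =
    (if ⌊ r ≟ s ⌋ then (if isEven r then a r - 1# else 0#)
     else if ⌊ s <? r ⌋ then (if isEven r then 0# else a s)
     else (if isEven s then 0# else a s))
    - x * (if ⌊ r ≟ s ⌋ then 1# else 0#)

  charPolyQ≡det : ∀ k → charPolyQ F k α x ≡ det F (2 *ℕ k) (toMatrix (2 *ℕ k) entry)
  charPolyQ≡det k = ≡.refl

  entry-diagonal : ∀ r → entry r r ≡ (if isEven r then a r - 1# else 0#) - x * 1#
  entry-diagonal r = ≡.cong₂ (λ e i → e - x * i) (if⌊≟⌋-refl r _ _) (if⌊≟⌋-refl r 1# 0#)

  entry-below : ∀ {r s} → s < r → entry r s ≡ (if isEven r then 0# else a s) - x * 0#
  entry-below s<r = ≡.cong₂ (λ e i → e - x * i)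
    (≡.trans (if⌊≟⌋-≢ _ _ (ℕ.>⇒≢ s<r)) (if⌊<?⌋-< _ _ s<r)) (if⌊≟⌋-≢ 1# 0# (ℕ.>⇒≢ s<r))

  entry-above : ∀ {r s} → r < s → entry r s ≡ (if isEven s then 0# else a s) - x * 0#
  entry-above r<s = ≡.cong₂ (λ e i → e - x * i)
    (≡.trans (if⌊≟⌋-≢ _ _ (ℕ.<⇒≢ r<s)) (if⌊<?⌋-≥ _ _ (ℕ.<⇒≤ r<s))) (if⌊≟⌋-≢ 1# 0# (ℕ.<⇒≢ r<s))

  A : ℕ → Carrier
  A zero    = - 1# - x
  A (suc r) = if isEven r then a (suc r) else - a (suc r)

  B : ℕ → Carrier
  B r = if isEven r then a (suc r) + x else - (a (suc r) - 1# - x)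

  C : ℕ → Carrier
  C zero    = 0#
  C (suc r) = if isEven r then a r - 1# - x else - (a r + x)

  private
    difference : ∀ {r s u v w} → entry r s ≡ u → entry (suc (suc r)) s ≡ v → u - v ≈ w →
                 rowDifferences entry (suc r) s ≈ w
    difference e₁ e₂ u-v≈w = trans (reflexive (≡.cong₂ _-_ e₁ e₂)) u-v≈w

    sameParity : ∀ r y →
      ((if isEven r then 0# else y) - x * 0#) - ((if isEven (suc (suc r)) then 0# else y) - x * 0#) ≈ 0#
    sameParity r y with isEven r
    ... | true  = -‿inverseʳ _
    ... | false = -‿inverseʳ _

    subdiagonal : ∀ r →
      ((if isEven r then a r - 1# else 0#) - x * 1#) - ((if isEven (suc (suc r)) then 0# else a r) - x * 0#)
        ≈ C (suc r)
    subdiagonal r with isEven r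
    ... | true  = solve 2 (λ y x → ((y :- con (+ 1)) :- x :* con (+ 1)) :- (con (+ 0) :- x :* con (+ 0)) := y :- con (+ 1) :- x) refl (a r) x
    ... | false = solve 2 (λ y x → (con (+ 0) :- x :* con (+ 1)) :- (y :- x :* con (+ 0)) := :- (y :+ x)) refl (a r) x

    diagonal : ∀ r →
      ((if isEven (suc r) then 0# else a (suc r)) - x * 0#) - ((if isEven (suc (suc r)) then 0# else a (suc r)) - x * 0#)
        ≈ A (suc r)
    diagonal r with isEven r
    ... | true  = solve 2 (λ y x → (y :- x :* con (+ 0)) :- (con (+ 0) :- x :* con (+ 0)) := y) refl (a (suc r)) x
    ... | false = solve 2 (λ y x → (con (+ 0) :- x :* con (+ 0)) :- (y :- x :* con (+ 0)) := :- y) refl (a (suc r)) x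

    superdiagonal : ∀ r →
      ((if isEven (suc (suc r)) then 0# else a (suc (suc r))) - x * 0#)
        - ((if isEven (suc (suc r)) then a (suc (suc r)) - 1# else 0#) - x * 1#) ≈ B (suc r)
    superdiagonal r with isEven r
    ... | true  = solve 2 (λ y x → (con (+ 0) :- x :* con (+ 0)) :- ((y :- con (+ 1)) :- x :* con (+ 1)) := :- (y :- con (+ 1) :- x)) refl (a (suc (suc r))) x
    ... | false = solve 2 (λ y x → (y :- x :* con (+ 0)) :- (con (+ 0) :- x :* con (+ 1)) := y :+ x) refl (a (suc (suc r))) x

  rowDifferences≈tridiagonal : ∀ r s → rowDifferences entry r s ≈ tridiagonal A B C r s
  rowDifferences≈tridiagonal zero zero = trans (reflexive (≡.cong₂ _-_ (entry-diagonal 0) (entry-below {1} {0} (s≤s z≤n))))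
    (solve 2 (λ y x → ((y :- con (+ 1)) :- x :* con (+ 1)) :- (y :- x :* con (+ 0)) := :- con (+ 1) :- x) refl (a 0) x)
  rowDifferences≈tridiagonal zero (suc zero) = trans (reflexive (≡.cong₂ _-_ (entry-above {0} {1} (s≤s z≤n)) (entry-diagonal 1)))
    (solve 2 (λ y x → (y :- x :* con (+ 0)) :- (con (+ 0) :- x :* con (+ 1)) := y :+ x) refl (a 1) x)
  rowDifferences≈tridiagonal zero (suc (suc s)) =
    trans (reflexive (≡.cong₂ _-_ (entry-above {0} {suc (suc s)} (s≤s z≤n)) (entry-above {1} {suc (suc s)} (s≤s (s≤s z≤n)))))
    (-‿inverseʳ _)
  rowDifferences≈tridiagonal (suc r) s with ℕ.<-cmp s r
  ... | tri< s<r _ _ = trans (difference (entry-below s<r) (entry-below (ℕ.m<n⇒m<1+n (ℕ.m<n⇒m<1+n s<r))) (sameParity r (a s)))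
    (reflexive (≡.sym (tridiagonal-farBelow A B C (suc r) s (s≤s s<r))))
  ... | tri≈ _ ≡.refl _ = trans (difference (entry-diagonal s) (entry-below (ℕ.m<n⇒m<1+n (ℕ.n<1+n s))) (subdiagonal s))
    (reflexive (≡.sym (tridiagonal-below A B C s)))
  ... | tri> _ _ s>r = aboveSubdiagonal s s>r
    where
    aboveSubdiagonal : ∀ s → r < s → rowDifferences entry (suc r) s ≈ tridiagonal A B C (suc r) s
    aboveSubdiagonal (suc s) r<1+s with r ≟ s
    ... | yes ≡.refl = trans (difference (entry-above (ℕ.n<1+n r)) (entry-below (ℕ.n<1+n (suc r))) (diagonal r))
      (reflexive (≡.sym (tridiagonal-diagonal A B C (suc r))))
    ... | no r≢s = aboveDiagonal s (ℕ.≤∧≢⇒< (ℕ.s≤s⁻¹ r<1+s) r≢s)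
      where
      aboveDiagonal : ∀ s → r < s → rowDifferences entry (suc r) (suc s) ≈ tridiagonal A B C (suc r) (suc s)
      aboveDiagonal (suc s) r<1+s with r ≟ s
      ... | yes ≡.refl = trans (difference (entry-above (ℕ.m<n⇒m<1+n (ℕ.n<1+n r))) (entry-diagonal (suc (suc r))) (superdiagonal r))
        (reflexive (≡.sym (tridiagonal-above A B C (suc r))))
      ... | no r≢s = trans (difference (entry-above (ℕ.m<n⇒m<1+n (ℕ.m<n⇒m<1+n r<s))) (entry-above (s≤s (s≤s r<s))) (-‿inverseʳ _))
        (reflexive (≡.sym (tridiagonal-farAbove A B C (suc r) (suc (suc s)) (s≤s (s≤s r<s)))))
        where
        r<s : r < s
        r<s = ℕ.≤∧≢⇒< (ℕ.s≤s⁻¹ r<1+s) r≢s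

  -- Indexed from 1, like betaSeq: denominator i is the denominator of β_i.
  denominator : ℕ → Carrier
  denominator i = if isEven i then fromℕ F (α i) + x else fromℕ F (α i) - 1# - x

  scale : ℕ → Carrier
  scale i = if isEven i then denominator i else - denominator i

  private
    *-⁻¹-cancel : ∀ p q → ¬ q ≈ 0# → q * (p * q ⁻¹) ≈ p
    *-⁻¹-cancel p q q≉0 = begin
      q * (p * q ⁻¹)   ≈⟨ solve 3 (λ q p q′ → q :* (p :* q′) := p :* (q :* q′)) refl q p (q ⁻¹) ⟩
      p * (q * q ⁻¹)   ≈⟨ *-congˡ (⁻¹-inverse q q≉0) ⟩
      p * 1#           ≈⟨ *-identityʳ p ⟩
      p                ∎

    -*-⁻¹-cancel : ∀ p q → ¬ q ≈ 0# → - q * (p * q ⁻¹) ≈ - p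
    -*-⁻¹-cancel p q q≉0 = trans (sym (-‿distribˡ-* q _)) (-‿cong (*-⁻¹-cancel p q q≉0))
      where open import Algebra.Properties.Ring ring using (-‿distribˡ-*)

  A≈scale*β : ∀ r → ¬ denominator (suc r) ≈ 0# → A r ≈ scale (suc r) * betaSeq F α x (suc r)
  A≈scale*β zero d≉0 = trans (solve 1 (λ x → :- con (+ 1) :- x := :- (con (+ 1) :+ x)) refl x)
    (sym (-*-⁻¹-cancel (1# + x) (a 0 - 1# - x) d≉0))
  A≈scale*β (suc r) d≉0 with isEven r
  ... | true  = sym (*-⁻¹-cancel (a (suc r)) (a (suc r) + x) d≉0)
  ... | false = sym (-*-⁻¹-cancel (a (suc r)) (a (suc r) - 1# - x) d≉0)

  B*C≈scale*scale : ∀ r → B r * C (suc r) ≈ scale (suc r) * scale (suc (suc r)) * (- 1# * 1#)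
  B*C≈scale*scale r with isEven r
  ... | true  = solve 3 (λ y z x → (z :+ x) :* (y :- con (+ 1) :- x)
                                := (:- (y :- con (+ 1) :- x)) :* (z :+ x) :* ((:- con (+ 1)) :* con (+ 1))) refl (a r) (a (suc r)) x
  ... | false = solve 3 (λ y z x → (:- (z :- con (+ 1) :- x)) :* (:- (y :+ x))
                                := (y :+ x) :* (:- (z :- con (+ 1) :- x)) :* ((:- con (+ 1)) :* con (+ 1))) refl (a r) (a (suc r)) x

  isEven-+2 : ∀ r → isEven (suc (suc r)) ≡ isEven r
  isEven-+2 r with isEven r
  ... | true  = ≡.refl
  ... | false = ≡.refl

  isEven-2* : ∀ k → isEven (2 *ℕ k) ≡ true
  isEven-2* zero    = ≡.refl
  isEven-2* (suc k) = ≡.trans (≡.cong isEven (ℕ.*-suc 2 k)) (≡.trans (isEven-+2 (2 *ℕ k)) (isEven-2* k))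

  entry-2k≈0 : ∀ k {s} → s < 2 *ℕ k → entry (2 *ℕ k) s ≈ 0#
  entry-2k≈0 k s<2k = begin
    entry (2 *ℕ k) _                                            ≡⟨ entry-below s<2k ⟩
    (if isEven (2 *ℕ k) then 0# else a _) - x * 0#              ≡⟨ ≡.cong (λ p → (if p then 0# else a _) - x * 0#) (isEven-2* k) ⟩
    0# - x * 0#                                                  ≈⟨ solve 1 (λ x → con (+ 0) :- x :* con (+ 0) := con (+ 0)) refl x ⟩
    0#                                                           ∎

  pairFactor : ℕ → Carrier
  pairFactor i = (fromℕ F (α (2 *ℕ i ∸ 1)) - 1# - x) * (fromℕ F (α (2 *ℕ i)) + x)

  prodFrom1-scale : ∀ k → prodFrom1 F (2 *ℕ k) scale ≈ negOnePow F k * prodFrom1 F k pairFactor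
  prodFrom1-scale zero    = sym (*-identityʳ 1#)
  prodFrom1-scale (suc k) = begin
    prodFrom1 F (2 *ℕ suc k) scale
      ≡⟨ ≡.cong (λ n → prodFrom1 F n scale) (ℕ.*-suc 2 k) ⟩
    (prodFrom1 F (2 *ℕ k) scale * scale (suc (2 *ℕ k))) * scale (suc (suc (2 *ℕ k)))
      ≡⟨ ≡.cong₂ (λ u v → (prodFrom1 F (2 *ℕ k) scale * u) * v) oddFactor evenFactor ⟩
    (prodFrom1 F (2 *ℕ k) scale * - (a (2 *ℕ k) - 1# - x)) * (a (suc (2 *ℕ k)) + x)
      ≈⟨ *-congʳ (*-congʳ (prodFrom1-scale k)) ⟩
    ((negOnePow F k * prodFrom1 F k pairFactor) * - (a (2 *ℕ k) - 1# - x)) * (a (suc (2 *ℕ k)) + x)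
      ≈⟨ solve 4 (λ s p u v → ((s :* p) :* (:- u)) :* v := (:- s) :* (p :* (u :* v))) refl _ _ _ _ ⟩
    - negOnePow F k * (prodFrom1 F k pairFactor * ((a (2 *ℕ k) - 1# - x) * (a (suc (2 *ℕ k)) + x)))
      ≡⟨ ≡.cong₂ (λ i j → - negOnePow F k * (prodFrom1 F k pairFactor * ((fromℕ F (α i) - 1# - x) * (fromℕ F (α j) + x))))
           (≡.cong (_∸ 1) (ℕ.*-suc 2 k)) (ℕ.*-suc 2 k) ⟨
    - negOnePow F k * (prodFrom1 F k pairFactor * pairFactor (suc k)) ∎
    where
    oddFactor : scale (suc (2 *ℕ k)) ≡ - (a (2 *ℕ k) - 1# - x)
    oddFactor with isEven (2 *ℕ k) | isEven-2* k
    ... | true | _ = ≡.refl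
    evenFactor : scale (suc (suc (2 *ℕ k))) ≡ a (suc (2 *ℕ k)) + x
    evenFactor with isEven (2 *ℕ k) | isEven-2* k
    ... | true | _ = ≡.refl

  private
    even-or-odd : ∀ r → ∃ (λ h → r ≡ 2 *ℕ h) ⊎ ∃ (λ h → r ≡ suc (2 *ℕ h))
    even-or-odd zero = inj₁ (0 , ≡.refl)
    even-or-odd (suc r) with even-or-odd r
    ... | inj₁ (h , ≡.refl) = inj₂ (h , ≡.refl)
    ... | inj₂ (h , ≡.refl) = inj₁ (suc h , ≡.sym (ℕ.*-suc 2 h))

    denominator-odd : ∀ h → denominator (suc (2 *ℕ h)) ≡ a (2 *ℕ h) - 1# - x
    denominator-odd h with isEven (2 *ℕ h) | isEven-2* h
    ... | true | _ = ≡.refl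

    denominator-even : ∀ h → denominator (suc (suc (2 *ℕ h))) ≡ a (suc (2 *ℕ h)) + x
    denominator-even h with isEven (2 *ℕ h) | isEven-2* h
    ... | true | _ = ≡.refl

    oddDenominator : ∀ h → denominator (suc (2 *ℕ h)) ≡ fromℕ F (α (2 *ℕ suc h ∸ 1)) - 1# - x
    oddDenominator h = ≡.trans (denominator-odd h) (≡.cong (λ i → fromℕ F (α (i ∸ 1)) - 1# - x) (≡.sym (ℕ.*-suc 2 h)))

    evenDenominator : ∀ h → denominator (suc (suc (2 *ℕ h))) ≡ fromℕ F (α (2 *ℕ suc h)) + x
    evenDenominator h = ≡.trans (denominator-even h) (≡.cong (λ i → fromℕ F (α i) + x) (≡.sym (ℕ.*-suc 2 h)))

  denominator≉0 : ∀ k →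
    (∀ i → 1 ≤ i → i ≤ k → ¬ (fromℕ F (α (2 *ℕ i ∸ 1)) - 1# - x ≈ 0#)) →
    (∀ i → 1 ≤ i → i ≤ k → ¬ (fromℕ F (α (2 *ℕ i)) + x ≈ 0#)) →
    ∀ r → r < 2 *ℕ k → ¬ denominator (suc r) ≈ 0#
  denominator≉0 k odd≉0 even≉0 r r<2k d≈0 with even-or-odd r
  ... | inj₁ (h , ≡.refl) = odd≉0 (suc h) (s≤s z≤n) (ℕ.*-cancelˡ-< 2 h k r<2k)
    (trans (reflexive (≡.sym (oddDenominator h))) d≈0)
  ... | inj₂ (h , ≡.refl) = even≉0 (suc h) (s≤s z≤n) (ℕ.*-cancelˡ-< 2 h k (ℕ.<-trans (ℕ.n<1+n _) r<2k))
    (trans (reflexive (≡.sym (evenDenominator h))) d≈0)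

mainTheorem12 : {c ℓ : Level} (F : Field c ℓ) → let open Field F in
    (k : ℕ) (α : ℕ → ℕ) (x : Carrier) →
    (∀ i → 1 ≤ i → i ≤ k → ¬ (fromℕ F (α (2 *ℕ i ∸ 1)) - 1# - x ≈ 0#)) →
    (∀ i → 1 ≤ i → i ≤ k → ¬ (fromℕ F (α (2 *ℕ i)) + x ≈ 0#)) →
    charPolyQ F k α x ≈
      negOnePow F k
        * (prodFrom1 F k (λ i → (fromℕ F (α (2 *ℕ i ∸ 1)) - 1# - x) * (fromℕ F (α (2 *ℕ i)) + x))
        * T F (2 *ℕ k) (betaSeq F α x))
mainTheorem12 F k α x odd≉0 even≉0 = begin
  charPolyQ F k α x                                              ≡⟨ charPolyQ≡det k ⟩
  det F n (toMatrix n entry)                                     ≈⟨ det-rowDifferences n entry (λ _ → entry-2k≈0 k) ⟩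
  det F n (toMatrix n (rowDifferences entry))                    ≈⟨ det-congℕ n (λ r s _ _ → rowDifferences≈tridiagonal r s) ⟩
  det F n (toMatrix n (tridiagonal A B C))
    ≈⟨ det-tridiagonal-scale n A B C (β ∘ suc) (λ _ → - 1#) (λ _ → 1#) scale
         (λ r r<n → A≈scale*β r (denominator≉0 k odd≉0 even≉0 r r<n)) (λ r _ → B*C≈scale*scale r) ⟩
  prodFrom1 F n scale * det F n (toMatrix n (tridiagonal (β ∘ suc) (λ _ → - 1#) (λ _ → 1#)))
    ≈⟨ *-cong (prodFrom1-scale k) (sym (T≈det-tridiagonal n β)) ⟩
  (negOnePow F k * prodFrom1 F k pairFactor) * T F n β           ≈⟨ *-assoc _ _ _ ⟩
  negOnePow F k * (prodFrom1 F k pairFactor * T F n β)          ∎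
  where
  open Field F
  open RowReduction F
  open Tridiagonal F
  open QuotientMatrix F α x
  open import Relation.Binary.Reasoning.Setoid setoid
  n : ℕ
  n = 2 *ℕ k
  β : ℕ → Carrier
  β = betaSeq F α x
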